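{- Let $n\ge1$, let $\overline{K_n}$ be the null graph (no edges) on $n$ vertices, let $G$ be any finite simple graph with $|V(G)|>1$, and let $G'=\overline{K_n}\vee G$. Let $S\subseteq V(\overline{K_n})$ be nonempty. Then $S$ is $G'$-admissible, and \[ |P(S;G')| = |S|!\cdot |V(G)|\cdot (|V(G')|-|S|-1)!. \]
   Context: The join $H_1\vee H_2$ has vertex set $V(H_1)\cup V(H_2)$ (disjoint) and edge set $E(H_1)\cup E(H_2)\cup\{\{u,w\}:u\in V(H_1),w\in V(H_2)\}$. For a graph $H$ with $N$ vertices, a labeling is a bijection $\ell:V(H)\to\{1,\ldots,N\}$; it has a peak at $v$ if $\deg_H(v)\ge2$ and $\ell(v)>\ell(w)$ for all neighbors $w$ of $v$. $P(S;H)$ is the set of labelings whose set of peaks is exactly $S$, and $S$ is $H$-admissible if $P(S;H)\neq\emptyset$. -}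

module Defs where

open import Data.Nat using (ℕ; _≤_; _<_; _+_; _*_; _∸_)
open import Data.Nat using (_!)
open import Data.Bool using (Bool; true; false; T)
open import Data.Bool.Properties using (T?)
open import Data.Fin using (Fin; splitAt)
import Data.Fin as F
open import Data.Fin.Subset using (Subset; _∈_)
open import Data.Vec using (count; allFin)
open import Data.Sum using (_⊎_; inj₁; inj₂)
open import Data.Product using (Σ; _×_; proj₁)
open import Data.Empty using (⊥)
open import Function.Definitions using (Bijective)
open import Function.Bundles using (_⇔_)
open import Relation.Binary.PropositionalEquality using (_≡_; refl; sym; trans)
open import Relation.Binary.Bundles using (Setoid)

record Graph : Set where
  field
    size  : ℕ
    adj   : Fin size → Fin size → Bool
    adj-sym : ∀ u w → adj u w ≡ adj w u
    adj-irrefl : ∀ u → adj u u ≡ false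

open Graph public

Vertex : Graph → Set
Vertex H = Fin (size H)

Adj : (H : Graph) → Vertex H → Vertex H → Set
Adj H u w = T (adj H u w)

deg : (H : Graph) → Vertex H → ℕ
deg H v = count (λ w → T? (adj H v w)) (allFin (size H))

nullGraph : ℕ → Graph
nullGraph n = record
  { size = n ; adj = λ _ _ → false ; adj-sym = λ _ _ → refl ; adj-irrefl = λ _ → refl }

-- Join: vertices of H₁ are Fin n₁ embedded on the left (inject+),
-- vertices of H₂ on the right (raise), via splitAt.
joinAdj : {a b : ℕ} → (Fin a → Fin a → Bool) → (Fin b → Fin b → Bool)
        → Fin a ⊎ Fin b → Fin a ⊎ Fin b → Bool
joinAdj f g (inj₁ i) (inj₁ j) = f i j
joinAdj f g (inj₂ i) (inj₂ j) = g i j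
joinAdj f g (inj₁ i) (inj₂ j) = true
joinAdj f g (inj₂ i) (inj₁ j) = true

joinAdj-sym : {a b : ℕ} (f : Fin a → Fin a → Bool) (g : Fin b → Fin b → Bool)
            → (∀ u w → f u w ≡ f w u) → (∀ u w → g u w ≡ g w u)
            → ∀ x y → joinAdj f g x y ≡ joinAdj f g y x
joinAdj-sym f g sf sg (inj₁ i) (inj₁ j) = sf i j
joinAdj-sym f g sf sg (inj₂ i) (inj₂ j) = sg i j
joinAdj-sym f g sf sg (inj₁ i) (inj₂ j) = refl
joinAdj-sym f g sf sg (inj₂ i) (inj₁ j) = refl

joinAdj-irrefl : {a b : ℕ} (f : Fin a → Fin a → Bool) (g : Fin b → Fin b → Bool)
               → (∀ u → f u u ≡ false) → (∀ u → g u u ≡ false)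
               → ∀ x → joinAdj f g x x ≡ false
joinAdj-irrefl f g rf rg (inj₁ i) = rf i
joinAdj-irrefl f g rf rg (inj₂ i) = rg i

_∨ᴳ_ : Graph → Graph → Graph
H₁ ∨ᴳ H₂ = record
  { size = size H₁ + size H₂
  ; adj = λ u w → joinAdj (adj H₁) (adj H₂) (splitAt (size H₁) u) (splitAt (size H₁) w)
  ; adj-sym = λ u w → joinAdj-sym (adj H₁) (adj H₂) (adj-sym H₁) (adj-sym H₂)
                    (splitAt (size H₁) u) (splitAt (size H₁) w)
  ; adj-irrefl = λ u → joinAdj-irrefl (adj H₁) (adj H₂) (adj-irrefl H₁) (adj-irrefl H₂)
                    (splitAt (size H₁) u)
  }

-- A labeling of H: a bijection V(H) → {1,…,N}, with labels represented by
-- Fin N = {0,…,N-1} (order-isomorphic shift; peaks only depend on order).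
record Labeling (H : Graph) : Set where
  field
    label     : Vertex H → Fin (size H)
    bijective : Bijective _≡_ _≡_ label

open Labeling public

IsPeak : (H : Graph) → Labeling H → Vertex H → Set
IsPeak H ℓ v = (2 ≤ deg H v) × (∀ w → Adj H v w → label ℓ w F.< label ℓ v)

PeakSetIs : (H : Graph) → Labeling H → (Vertex H → Set) → Set
PeakSetIs H ℓ S = ∀ v → IsPeak H ℓ v ⇔ S v

P : (H : Graph) → (Vertex H → Set) → Setoid _ _
P H S = record
  { Carrier = Σ (Labeling H) (λ ℓ → PeakSetIs H ℓ S)
  ; _≈_ = λ x y → ∀ v → label (proj₁ x) v ≡ label (proj₁ y) v
  ; isEquivalence = record
      { refl = λ v → refl
      ; sym = λ p v → sym (p v)
      ; trans = λ p q v → trans (p v) (q v) }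
  }

Admissible : (H : Graph) → (Vertex H → Set) → Set
Admissible H S = Setoid.Carrier (P H S)

leftSubset : (n : ℕ) (G : Graph) → Subset n → Vertex (nullGraph n ∨ᴳ G) → Set
leftSubset n G S v with splitAt n v
... | inj₁ i = i ∈ S
... | inj₂ _ = ⊥

module Submission where

-- Every vertex of H has a kind: 'sel' (a vertex of S ⊆ V(K̄ₙ)), 'unsel'
-- (another vertex of K̄ₙ) or 'hub' (a vertex of G).  A null vertex has
-- exactly the hubs as neighbours, hence degree m ≥ 2.  So, as S ≠ ∅, a
-- labeling ℓ has peak set exactly S iff it *separates*: every sel vertex is
-- above every hub and every unsel vertex is below some hub.
--
-- Read a labeling as a ranking permutation τ (rank 0 = largest label) and
-- write down the kind of each rank.  Separation then says the first k = |S|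
-- ranks are sel and rank k is a hub; the rest is arbitrary.  Counting
-- permutations by the image of 0 (product rule, via insert/remove) gives
-- k! · m · (N-k-1)! good rankings, N = n + m.

open import Defs
open import Level using (0ℓ)
open import Data.Nat using (ℕ; zero; suc; _+_; _*_; _∸_; _≤_; _<_; _!; s≤s; z≤n; s<s; s<s⁻¹)
import Data.Nat.Properties as ℕ
open import Data.Fin using (Fin; zero; suc; toℕ; splitAt; opposite; punchIn; punchOut; _↑ˡ_; _↑ʳ_)
import Data.Fin as F
import Data.Fin.Properties as FinP
open import Data.Fin.Subset using (Subset; Nonempty; ∣_∣)
open import Data.Fin.Subset.Properties using (∣p∣≤n)
open import Data.Fin.Permutation
  using (Permutation′; _⟨$⟩ʳ_; _⟨$⟩ˡ_; inverseˡ; inverseʳ; remove; insert; permutation;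
         insert-remove; remove-insert; punchIn-permute)
import Data.Fin.Permutation as Perm
open import Data.Bool using (Bool; true; false; T)
open import Data.Bool.Properties using (T?)
open import Data.Vec using ([]; _∷_; lookup; count; tabulate)
open import Data.Vec.Properties using (lookup⇒[]=; []=⇒lookup)
open import Data.Sum using (_⊎_; inj₁; inj₂; map₁)
open import Data.Product using (Σ; ∃; _×_; _,_; proj₁; proj₂)
open import Data.Product.Relation.Binary.Pointwise.NonDependent using (_×ₛ_)
open import Data.Unit using (⊤; tt)
open import Data.Empty using (⊥-elim)
open import Function using (_∘_)
open import Function.Bundles using (Inverse; _⇔_; mk⇔; Equivalence)
import Function.Construct.Composition as Composition
import Function.Construct.Symmetry as Symmetry
import Function.Consequences.Setoid as Consequences
open import Relation.Nullary using (¬_; Dec; yes; no)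
open import Relation.Nullary.Decidable using (_→-dec_)
open import Relation.Unary using (Decidable)
open import Relation.Binary.Bundles using (Setoid)
open import Relation.Binary.Definitions using (tri<; tri≈; tri>)
import Relation.Binary.Construct.On as On
open import Relation.Binary.PropositionalEquality
open import Axiom.UniquenessOfIdentityProofs.WithK using (uip)

open Setoid using (Carrier)

mkInverse : {A B : Setoid 0ℓ 0ℓ}
  (f : Carrier A → Carrier B) (g : Carrier B → Carrier A)
  → (∀ {x y} → Setoid._≈_ A x y → Setoid._≈_ B (f x) (f y))
  → (∀ {x y} → Setoid._≈_ B x y → Setoid._≈_ A (g x) (g y))
  → (∀ y → Setoid._≈_ B (f (g y)) y)
  → (∀ x → Setoid._≈_ A (g (f x)) x)
  → Inverse A B
mkInverse {A} {B} f g f-cong g-cong fg gf = record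
  { to = f ; from = g ; to-cong = f-cong ; from-cong = g-cong
  ; inverse = Consequences.strictlyInverseˡ⇒inverseˡ A B f-cong fg
            , Consequences.strictlyInverseʳ⇒inverseʳ A B g-cong gf
  }

Enumeration : ℕ → Setoid 0ℓ 0ℓ → Set
Enumeration c A = Inverse (setoid (Fin c)) A

infixl 5 _⨾_
_⨾_ : {c : ℕ} {A B : Setoid 0ℓ 0ℓ} → Enumeration c A → Inverse A B → Enumeration c B
_⨾_ = Composition.inverse

Restrict : (A : Setoid 0ℓ 0ℓ) → (Carrier A → Set) → Setoid 0ℓ 0ℓ
Restrict A P = On.setoid {B = Σ (Carrier A) P} A proj₁

restrict-⇔ : {A : Setoid 0ℓ 0ℓ} {P P′ : Carrier A → Set}
  → (∀ x → P x ⇔ P′ x) → Inverse (Restrict A P) (Restrict A P′)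
restrict-⇔ {A} P⇔P′ =
  mkInverse (λ (x , p) → x , Equivalence.to (P⇔P′ x) p)
            (λ (x , p) → x , Equivalence.from (P⇔P′ x) p)
            (λ e → e) (λ e → e) (λ _ → Setoid.refl A) (λ _ → Setoid.refl A)

Pairs : {X : Set} (Q : X → Set) (B : Setoid 0ℓ 0ℓ) (R : X → Carrier B → Set) → Setoid 0ℓ 0ℓ
Pairs {X} Q B R =
  On.setoid {B = Σ (Σ X Q) (λ xq → Σ (Carrier B) (R (proj₁ xq)))}
            (setoid X ×ₛ B) (λ p → proj₁ (proj₁ p) , proj₁ (proj₂ p))

-- Product rule: a choices of x, and for each x (with any witness of Q x)
-- c choices of b, give a * c pairs.  Proof-irrelevance of Q makes the inner
-- enumeration independent of the witness.
enumerate-pairs : {X : Set} {Q : X → Set} {B : Setoid 0ℓ 0ℓ} {R : X → Carrier B → Set} {a c : ℕ}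
  → (∀ {x} (q q′ : Q x) → q ≡ q′)
  → Enumeration a (Restrict (setoid X) Q)
  → (∀ x → (q : Q x) → Enumeration c (Restrict B (R x)))
  → Enumeration (a * c) (Pairs Q B R)
enumerate-pairs {X} {Q} {B} {R} {a} {c} Q-irr EQ ER =
  FinP.*↔× {a} {c} ⨾ mkInverse pair unpair (Setoid.reflexive (Pairs Q B R) ∘ cong pair)
                              unpair-cong pair-unpair unpair-pair
  where
  module B = Setoid B
  pair : Fin a × Fin c → Carrier (Pairs Q B R)
  pair (i , j) = Inverse.to EQ i , Inverse.to (ER _ (proj₂ (Inverse.to EQ i))) j

  unpair : Carrier (Pairs Q B R) → Fin a × Fin c
  unpair ((x , q) , br) = Inverse.from EQ (x , q) , Inverse.from (ER x q) br

  inner-from-cong : ∀ {x x′} → x ≡ x′ → (q : Q x) (q′ : Q x′)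
    → {b : Σ (Carrier B) (R x)} {b′ : Σ (Carrier B) (R x′)} → proj₁ b B.≈ proj₁ b′ → Inverse.from (ER x q) b ≡ Inverse.from (ER x′ q′) b′
  inner-from-cong refl q q′ e rewrite Q-irr q q′ = Inverse.from-cong (ER _ q′) e

  inner-to-from : ∀ {x x′} → x ≡ x′ → (q : Q x) (q′ : Q x′) (b : Σ (Carrier B) (R x′))
    → proj₁ (Inverse.to (ER x q) (Inverse.from (ER x′ q′) b)) B.≈ proj₁ b
  inner-to-from refl q q′ b rewrite Q-irr q q′ = Inverse.strictlyInverseˡ (ER _ q′) b

  unpair-cong : ∀ {p p′} → Setoid._≈_ (Pairs Q B R) p p′ → unpair p ≡ unpair p′
  unpair-cong {(x , q) , _} {(x′ , q′) , _} (x≡x′ , b≈b′) =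
    cong₂ _,_ (Inverse.from-cong EQ x≡x′) (inner-from-cong x≡x′ q q′ b≈b′)

  pair-unpair : ∀ p → Setoid._≈_ (Pairs Q B R) (pair (unpair p)) p
  pair-unpair ((x , q) , b) =
    let x↺ = Inverse.strictlyInverseˡ EQ (x , q)
    in x↺ , inner-to-from x↺ _ q b

  unpair-pair : ∀ ij → unpair (pair ij) ≡ ij
  unpair-pair (i , j) = cong₂ _,_ (Inverse.strictlyInverseʳ EQ i) (Inverse.strictlyInverseʳ (ER _ _) j)

Permutations : ℕ → Setoid 0ℓ 0ℓ
Permutations N = record
  { Carrier = Permutation′ N
  ; _≈_ = Perm._≈_
  ; isEquivalence = record
      { refl = λ _ → refl ; sym = λ p i → sym (p i) ; trans = λ p q i → trans (p i) (q i) }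
  }

all-of : ∀ M → Enumeration M (Restrict (setoid (Fin M)) (λ _ → ⊤))
all-of M = mkInverse (λ i → i , tt) proj₁ (λ e → e) (λ e → e) (λ _ → refl) (λ _ → refl)

head : ∀ {N} → Permutation′ (suc N) → Fin (suc N)
head τ = τ ⟨$⟩ʳ zero

tail : ∀ {N} → Permutation′ (suc N) → Permutation′ N
tail = remove zero

punchOut-cong₂ : ∀ {N} {a a′ b b′ : Fin (suc N)} (a≢b : a ≢ b) (a′≢b′ : a′ ≢ b′)
  → a ≡ a′ → b ≡ b′ → punchOut a≢b ≡ punchOut a′≢b′
punchOut-cong₂ {a = a} _ _ refl refl = FinP.punchOut-cong a refl

tail-cong : ∀ {N} {τ τ′ : Permutation′ (suc N)} → τ Perm.≈ τ′ → tail τ Perm.≈ tail τ′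
tail-cong e j = punchOut-cong₂ _ _ (e zero) (e (suc j))

insert₀-cong : ∀ {N} {x x′ : Fin (suc N)} {σ σ′ : Permutation′ N}
  → x ≡ x′ → σ Perm.≈ σ′ → insert zero x σ Perm.≈ insert zero x′ σ′
insert₀-cong {x = x} refl σ≈σ′ k with zero FinP.≟ k
... | yes _   = refl
... | no 0≢k = cong (punchIn x) (σ≈σ′ (punchOut 0≢k))

split-head : ∀ {N} {Q : Fin (suc N) → Set} {R : Fin (suc N) → Permutation′ N → Set}
  → (∀ x {σ σ′} → σ Perm.≈ σ′ → R x σ → R x σ′)
  → Inverse (Restrict (Permutations (suc N)) (λ τ → Q (head τ) × R (head τ) (tail τ)))
            (Pairs Q (Permutations N) R)
split-head R-resp = mkInverse
  (λ (τ , q , r) → (head τ , q) , tail τ , r)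
  (λ ((x , q) , σ , r) → insert zero x σ , q , R-resp x (λ j → sym (remove-insert zero x σ j)) r)
  (λ {(τ , _)} {(τ′ , _)} τ≈τ′ → τ≈τ′ zero , tail-cong {τ = τ} {τ′} τ≈τ′)
  (λ (x≡x′ , σ≈σ′) → insert₀-cong x≡x′ σ≈σ′)
  (λ ((x , _) , σ , _) → refl , remove-insert zero x σ)
  (λ (τ , _) → insert-remove zero τ)

count-by-head : ∀ {N a c} {P : Permutation′ (suc N) → Set}
  (Q : Fin (suc N) → Set) (R : Fin (suc N) → Permutation′ N → Set)
  → (∀ {x} (q q′ : Q x) → q ≡ q′)
  → (∀ x {σ σ′} → σ Perm.≈ σ′ → R x σ → R x σ′)
  → (∀ τ → P τ ⇔ (Q (head τ) × R (head τ) (tail τ)))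
  → Enumeration a (Restrict (setoid (Fin (suc N))) Q)
  → (∀ x → Q x → Enumeration c (Restrict (Permutations N) (R x)))
  → Enumeration (a * c) (Restrict (Permutations (suc N)) P)
count-by-head Q R Q-irr R-resp P⇔QR EQ ER =
  enumerate-pairs Q-irr EQ ER
    ⨾ Symmetry.inverse (split-head R-resp)
    ⨾ Symmetry.inverse (restrict-⇔ P⇔QR)

permutations : ∀ N → Enumeration (N !) (Restrict (Permutations N) (λ _ → ⊤))
permutations zero =
  mkInverse (λ _ → Perm.id , tt) (λ _ → zero) (λ _ ()) (λ _ → refl) (λ _ ()) (λ { zero → refl })
permutations (suc N) =
  count-by-head (λ _ → ⊤) (λ _ _ → ⊤) (λ _ _ → refl) (λ _ _ _ → tt)
                (λ _ → mk⇔ (λ _ → tt , tt) (λ _ → tt)) (all-of (suc N)) (λ _ _ → permutations N)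

-- The three kinds of vertices of K̄ₙ ∨ G: in S ('sel'), in K̄ₙ but not in S
-- ('unsel'), and in G ('hub').
data Kind : Set where
  sel unsel hub : Kind

_≟ᵏ_ : (a b : Kind) → Dec (a ≡ b)
sel   ≟ᵏ sel   = yes refl
unsel ≟ᵏ unsel = yes refl
hub   ≟ᵏ hub   = yes refl
sel   ≟ᵏ unsel = no λ ()
sel   ≟ᵏ hub   = no λ ()
unsel ≟ᵏ sel   = no λ ()
unsel ≟ᵏ hub   = no λ ()
hub   ≟ᵏ sel   = no λ ()
hub   ≟ᵏ unsel = no λ ()

sel≢hub : sel ≢ hub
sel≢hub ()

unsel≢hub : unsel ≢ hub
unsel≢hub ()

sel≢unsel : sel ≢ unsel
sel≢unsel ()

occ : ∀ {N} → (Fin N → Kind) → Kind → ℕ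
occ {zero}  f c = 0
occ {suc N} f c with f zero ≟ᵏ c
... | yes _ = suc (occ (f ∘ suc) c)
... | no _  = occ (f ∘ suc) c

Fibre : ∀ {N} → (Fin N → Kind) → Kind → Setoid 0ℓ 0ℓ
Fibre {N} f c = Restrict (setoid (Fin N)) (λ x → f x ≡ c)

fibre-cong : ∀ {N} {f : Fin N → Kind} {c} {A : Set} (F : Carrier (Fibre f c) → A)
  → ∀ {y y′} → proj₁ y ≡ proj₁ y′ → F y ≡ F y′
fibre-cong F {x , q} {.x , q′} refl = cong (λ q → F (x , q)) (uip q q′)

fibre-enumeration : ∀ {N} (f : Fin N → Kind) c → Enumeration (occ f c) (Fibre f c)
fibre-enumeration {zero} f c =
  mkInverse (λ ()) (λ { (() , _) }) (λ { {()} }) (λ { {() , _} }) (λ { (() , _) }) (λ ())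
fibre-enumeration {suc N} f c with f zero ≟ᵏ c
... | yes f0≡c = mkInverse to from (cong (proj₁ ∘ to)) (fibre-cong from) to-from from-to
  where
  E : Enumeration (occ (f ∘ suc) c) (Fibre (f ∘ suc) c)
  E = fibre-enumeration (f ∘ suc) c
  to : Fin (suc (occ (f ∘ suc) c)) → Carrier (Fibre f c)
  to zero    = zero , f0≡c
  to (suc i) = suc (proj₁ (Inverse.to E i)) , proj₂ (Inverse.to E i)
  from : Carrier (Fibre f c) → Fin (suc (occ (f ∘ suc) c))
  from (zero  , _) = zero
  from (suc x , q) = suc (Inverse.from E (x , q))
  to-from : ∀ y → proj₁ (to (from y)) ≡ proj₁ y
  to-from (zero  , _) = refl
  to-from (suc x , q) = cong suc (Inverse.strictlyInverseˡ E (x , q))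
  from-to : ∀ i → from (to i) ≡ i
  from-to zero    = refl
  from-to (suc i) = cong suc (Inverse.strictlyInverseʳ E i)
... | no f0≢c = mkInverse to from (cong (proj₁ ∘ to)) (fibre-cong from) to-from from-to
  where
  E : Enumeration (occ (f ∘ suc) c) (Fibre (f ∘ suc) c)
  E = fibre-enumeration (f ∘ suc) c
  to : Fin (occ (f ∘ suc) c) → Carrier (Fibre f c)
  to i = suc (proj₁ (Inverse.to E i)) , proj₂ (Inverse.to E i)
  from : Carrier (Fibre f c) → Fin (occ (f ∘ suc) c)
  from (zero  , q) = ⊥-elim (f0≢c q)
  from (suc x , q) = Inverse.from E (x , q)
  to-from : ∀ y → proj₁ (to (from y)) ≡ proj₁ y
  to-from (zero  , q) = ⊥-elim (f0≢c q)
  to-from (suc x , q) = cong suc (Inverse.strictlyInverseˡ E (x , q))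
  from-to : ∀ i → from (to i) ≡ i
  from-to = Inverse.strictlyInverseʳ E

absent : ∀ {N} {f : Fin N → Kind} {c} → occ f c ≡ 0 → ∀ x → f x ≢ c
absent {f = f} {c} none x fx≡c =
  FinP.¬Fin0 (subst Fin none (Inverse.from (fibre-enumeration f c) (x , fx≡c)))

present : ∀ {N} {f : Fin N → Kind} {c k} → occ f c ≡ suc k → ∃ λ x → f x ≡ c
present {f = f} {c} some = Inverse.to (fibre-enumeration f c) (subst Fin (sym some) zero)

occ-none : ∀ {N} (f : Fin N → Kind) c → (∀ x → f x ≢ c) → occ f c ≡ 0
occ-none {zero}  f c _ = refl
occ-none {suc N} f c none with f zero ≟ᵏ c
... | yes f0≡c = ⊥-elim (none zero f0≡c)
... | no _     = occ-none (f ∘ suc) c (none ∘ suc)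

occ-const : ∀ m c → occ {m} (λ _ → c) c ≡ m
occ-const zero    c = refl
occ-const (suc m) c with c ≟ᵏ c
... | yes _   = cong suc (occ-const m c)
... | no c≢c = ⊥-elim (c≢c refl)

occ-punchIn-hit : ∀ {N} (f : Fin (suc N) → Kind) {c} x → f x ≡ c
  → occ f c ≡ suc (occ (f ∘ punchIn x) c)
occ-punchIn-hit f {c} zero fx≡c with f zero ≟ᵏ c
... | yes _    = refl
... | no f0≢c = ⊥-elim (f0≢c fx≡c)
occ-punchIn-hit {suc N} f {c} (suc x) fx≡c with f zero ≟ᵏ c
... | yes _ = cong suc (occ-punchIn-hit (f ∘ suc) x fx≡c)
... | no _  = occ-punchIn-hit (f ∘ suc) x fx≡c

occ-punchIn-miss : ∀ {N} (f : Fin (suc N) → Kind) {c} x → f x ≢ c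
  → occ f c ≡ occ (f ∘ punchIn x) c
occ-punchIn-miss f {c} zero fx≢c with f zero ≟ᵏ c
... | yes f0≡c = ⊥-elim (fx≢c f0≡c)
... | no _      = refl
occ-punchIn-miss {suc N} f {c} (suc x) fx≢c with f zero ≟ᵏ c
... | yes _ = cong suc (occ-punchIn-miss (f ∘ suc) x fx≢c)
... | no _  = occ-punchIn-miss (f ∘ suc) x fx≢c

occ-splitAt : ∀ n {m} (h : Fin n ⊎ Fin m → Kind) c
  → occ (h ∘ splitAt n) c ≡ occ (h ∘ inj₁) c + occ (h ∘ inj₂) c
occ-splitAt zero    h c = refl
occ-splitAt (suc n) h c with h (inj₁ zero) ≟ᵏ c
... | yes _ = cong suc (occ-splitAt n (h ∘ map₁ suc) c)
... | no _  = occ-splitAt n (h ∘ map₁ suc) c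

-- g i is the kind of the vertex of rank i (rank 0 carries the largest
-- label).  The ranking is good when every sel precedes every hub and every
-- unsel is preceded by some hub.
Good : ∀ {N} → (Fin N → Kind) → Set
Good g = (∀ i j → g i ≡ sel → g j ≡ hub → i F.< j)
       × (∀ i → g i ≡ unsel → ∃ λ j → g j ≡ hub × j F.< i)

Good-resp : ∀ {N} {g h : Fin N → Kind} → (∀ i → g i ≡ h i) → Good g → Good h
Good-resp g≗h (before , covered) =
  (λ i j p q → before i j (trans (g≗h i) p) (trans (g≗h j) q)) ,
  (λ i p → let (j , q , j<i) = covered i (trans (g≗h i) p) in j , trans (sym (g≗h j)) q , j<i)

good-without-sel : ∀ {N} (g : Fin (suc N) → Kind) → (∀ i → g i ≢ sel)
  → Good g ⇔ g zero ≡ hub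
good-without-sel g no-sel = mk⇔ starts-with-hub good
  where
  starts-with-hub : Good g → g zero ≡ hub
  starts-with-hub (_ , covered) with g zero in e
  ... | sel = ⊥-elim (no-sel zero e)
  ... | unsel with covered zero e
  ...   | (_ , _ , ())
  starts-with-hub _ | hub = refl

  good : g zero ≡ hub → Good g
  good g0≡hub = (λ i _ p _ → ⊥-elim (no-sel i p)) , covered
    where
    covered : ∀ i → g i ≡ unsel → ∃ λ j → g j ≡ hub × j F.< i
    covered zero p with trans (sym g0≡hub) p
    ... | ()
    covered (suc i) _ = zero , g0≡hub , s≤s z≤n

good-with-sel : ∀ {N} (g : Fin (suc N) → Kind) → (∃ λ i → g i ≡ sel)
  → Good g ⇔ (g zero ≡ sel × Good (g ∘ suc))
good-with-sel g (i₀ , gi₀≡sel) = mk⇔ (λ G → starts-with-sel G , uncons G) cons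
  where
  starts-with-sel : Good g → g zero ≡ sel
  starts-with-sel (before , covered) with g zero in e
  ... | sel = refl
  ... | unsel with covered zero e
  ...   | (_ , _ , ())
  starts-with-sel (before , _) | hub with before i₀ zero gi₀≡sel e
  ... | ()

  uncons : Good g → Good (g ∘ suc)
  uncons G@(before , covered) =
    (λ i j p q → s<s⁻¹ (before (suc i) (suc j) p q)) , covered′
    where
    covered′ : ∀ i → g (suc i) ≡ unsel → ∃ λ j → g (suc j) ≡ hub × j F.< i
    covered′ i p with covered (suc i) p
    ... | (zero , q , _) with trans (sym (starts-with-sel G)) q
    ...   | ()
    covered′ i p | (suc j , q , j<i) = j , q , s<s⁻¹ j<i

  cons : g zero ≡ sel × Good (g ∘ suc) → Good g
  cons (g0≡sel , before , covered) = before′ , covered′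
    where
    before′ : ∀ i j → g i ≡ sel → g j ≡ hub → i F.< j
    before′ i zero _ q with trans (sym g0≡sel) q
    ... | ()
    before′ zero    (suc j) _ _ = s≤s z≤n
    before′ (suc i) (suc j) p q = s<s (before i j p q)
    covered′ : ∀ i → g i ≡ unsel → ∃ λ j → g j ≡ hub × j F.< i
    covered′ zero p with trans (sym g0≡sel) p
    ... | ()
    covered′ (suc i) p = let (j , q , j<i) = covered i p in suc j , q , s<s j<i

-- (suc k)! · m · r! = (suc k) · (k! · m · r!): peeling off the first sel.
factorial-step : ∀ k m s → suc k * (k ! * m * s) ≡ suc k ! * m * s
factorial-step k m s = begin
  suc k * (k ! * m * s)   ≡⟨ ℕ.*-assoc (suc k) (k ! * m) s ⟨
  suc k * (k ! * m) * s   ≡⟨ cong (_* s) (ℕ.*-assoc (suc k) (k !) m) ⟨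
  suc k ! * m * s         ∎
  where open ≡-Reasoning

GoodRankings : ∀ {N} → (Fin N → Kind) → Setoid 0ℓ 0ℓ
GoodRankings {N} f = Restrict (Permutations N) (λ τ → Good (f ∘ (τ ⟨$⟩ʳ_)))

good-rankings : ∀ {N} k r m → N ≡ k + suc r → (f : Fin N → Kind)
  → occ f sel ≡ k → occ f hub ≡ m
  → Enumeration (k ! * m * r !) (GoodRankings f)
good-rankings zero r m refl f sels hubs =
  subst (λ c → Enumeration c (GoodRankings f)) (cong (_* r !) (sym (ℕ.*-identityˡ m)))
    (count-by-head (λ x → f x ≡ hub) (λ _ _ → ⊤) uip (λ _ _ _ → tt) good⇔
       (subst (λ c → Enumeration c (Fibre f hub)) hubs (fibre-enumeration f hub))
       (λ _ _ → permutations r))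
  where
  good⇔ : ∀ τ → Good (f ∘ (τ ⟨$⟩ʳ_)) ⇔ (f (head τ) ≡ hub × ⊤)
  good⇔ τ = mk⇔ (λ G → Equivalence.to E G , tt) (Equivalence.from E ∘ proj₁)
    where
    E : Good (f ∘ (τ ⟨$⟩ʳ_)) ⇔ f (head τ) ≡ hub
    E = good-without-sel (f ∘ (τ ⟨$⟩ʳ_)) (λ i → absent {f = f} sels (τ ⟨$⟩ʳ i))
good-rankings (suc k) r m refl f sels hubs =
  subst (λ c → Enumeration c (GoodRankings f)) (factorial-step k m (r !))
    (count-by-head (λ x → f x ≡ sel) R uip R-resp good⇔
       (subst (λ c → Enumeration c (Fibre f sel)) sels (fibre-enumeration f sel))
       (λ x fx≡sel → good-rankings k r m refl (f ∘ punchIn x)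
          (ℕ.suc-injective (trans (sym (occ-punchIn-hit f x fx≡sel)) sels))
          (trans (sym (occ-punchIn-miss f x (sel≢hub ∘ trans (sym fx≡sel)))) hubs)))
  where
  -- the tail ranks the vertices other than the head x
  R : Fin (suc k + suc r) → Permutation′ (k + suc r) → Set
  R x σ = Good (f ∘ punchIn x ∘ (σ ⟨$⟩ʳ_))

  R-resp : ∀ x {σ σ′} → σ Perm.≈ σ′ → R x σ → R x σ′
  R-resp x σ≈σ′ = Good-resp (λ i → cong (f ∘ punchIn x) (σ≈σ′ i))

  rest≗tail : ∀ τ i → f (τ ⟨$⟩ʳ suc i) ≡ f (punchIn (head τ) (tail τ ⟨$⟩ʳ i))
  rest≗tail τ i = cong f (punchIn-permute τ zero i)

  good⇔ : ∀ τ → Good (f ∘ (τ ⟨$⟩ʳ_)) ⇔ (f (head τ) ≡ sel × R (head τ) (tail τ))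
  good⇔ τ = mk⇔
    (λ G → let (h , G′) = Equivalence.to E G in h , Good-resp (rest≗tail τ) G′)
    (λ (h , G′) → Equivalence.from E (h , Good-resp (sym ∘ rest≗tail τ) G′))
    where
    some-sel : ∃ λ i → f (τ ⟨$⟩ʳ i) ≡ sel
    some-sel = let (x , fx≡sel) = present {f = f} sels
               in τ ⟨$⟩ˡ x , trans (cong f (inverseʳ τ)) fx≡sel
    E : Good (f ∘ (τ ⟨$⟩ʳ_)) ⇔ (f (head τ) ≡ sel × Good (f ∘ (τ ⟨$⟩ʳ_) ∘ suc))
    E = good-with-sel (f ∘ (τ ⟨$⟩ʳ_)) some-sel

Separated : ∀ {N} → (Fin N → Kind) → (Fin N → Fin N) → Set
Separated κ key = (∀ s w → κ s ≡ sel → κ w ≡ hub → key w F.< key s)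
                × (∀ u → κ u ≡ unsel → ∃ λ w → κ w ≡ hub × key u F.< key w)

opposite-< : ∀ {N} {i j : Fin N} → i F.< j → opposite j F.< opposite i
opposite-< {i = i} {j} i<j rewrite FinP.opposite-prop i | FinP.opposite-prop j =
  ℕ.∸-monoʳ-< (s<s i<j) (FinP.toℕ<n j)

opposite-<⁻ : ∀ {N} {i j : Fin N} → opposite j F.< opposite i → i F.< j
opposite-<⁻ {i = i} {j} oj<oi with FinP.<-cmp i j
... | tri< i<j _ _ = i<j
... | tri≈ _ refl _ = ⊥-elim (ℕ.<-irrefl refl oj<oi)
... | tri> _ _ j<i = ⊥-elim (ℕ.<-asym oj<oi (opposite-< j<i))

opposite-injective : ∀ {N} {i j : Fin N} → opposite i ≡ opposite j → i ≡ j
opposite-injective {i = i} {j} e = begin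
  i                       ≡⟨ FinP.opposite-involutive i ⟨
  opposite (opposite i)   ≡⟨ cong opposite e ⟩
  opposite (opposite j)   ≡⟨ FinP.opposite-involutive j ⟩
  j                       ∎
  where open ≡-Reasoning

separated⇔good : ∀ {N} (κ : Fin N → Kind) (key : Fin N → Fin N) (τ : Permutation′ N)
  → (∀ v → key v ≡ opposite (τ ⟨$⟩ˡ v)) → Separated κ key ⇔ Good (κ ∘ (τ ⟨$⟩ʳ_))
separated⇔good κ key τ key≡ = mk⇔ to from
  where
  rank : Fin _ → Fin _
  rank = τ ⟨$⟩ˡ_

  key<⇒rank< : ∀ {v w} → key w F.< key v → rank v F.< rank w
  key<⇒rank< {v} {w} rewrite key≡ v | key≡ w = opposite-<⁻

  rank<⇒key< : ∀ {v w} → rank v F.< rank w → key w F.< key v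
  rank<⇒key< {v} {w} rewrite key≡ v | key≡ w = opposite-<

  kind-at-rank : ∀ {v c} → κ v ≡ c → κ (τ ⟨$⟩ʳ rank v) ≡ c
  kind-at-rank = trans (cong κ (inverseʳ τ))

  to : Separated κ key → Good (κ ∘ (τ ⟨$⟩ʳ_))
  to (above , below) =
    (λ i j p q → subst₂ F._<_ (inverseˡ τ) (inverseˡ τ) (key<⇒rank< (above _ _ p q))) ,
    (λ i p → let (w , q , u<w) = below _ p
             in rank w , kind-at-rank q , subst (rank w F.<_) (inverseˡ τ) (key<⇒rank< u<w))

  from : Good (κ ∘ (τ ⟨$⟩ʳ_)) → Separated κ key
  from (before , covered) =
    (λ s w p q → rank<⇒key< (before (rank s) (rank w) (kind-at-rank p) (kind-at-rank q))) ,
    (λ u p → let (j , q , j<u) = covered (rank u) (kind-at-rank p)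
             in τ ⟨$⟩ʳ j , q , rank<⇒key< {τ ⟨$⟩ʳ j} {u} (subst (F._< rank u) (sym (inverseˡ τ)) j<u))

module _ (H : Graph) where

  labeling-of : Permutation′ (size H) → Labeling H
  labeling-of τ = record
    { label     = λ v → opposite (τ ⟨$⟩ˡ v)
    ; bijective = injective , surjective }
    where
    injective : ∀ {v w} → opposite (τ ⟨$⟩ˡ v) ≡ opposite (τ ⟨$⟩ˡ w) → v ≡ w
    injective {v} {w} e = begin
      v                        ≡⟨ inverseʳ τ ⟨
      τ ⟨$⟩ʳ (τ ⟨$⟩ˡ v)        ≡⟨ cong (τ ⟨$⟩ʳ_) (opposite-injective e) ⟩
      τ ⟨$⟩ʳ (τ ⟨$⟩ˡ w)        ≡⟨ inverseʳ τ ⟩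
      w                        ∎
      where open ≡-Reasoning
    surjective : ∀ i → ∃ λ v → ∀ {w} → w ≡ v → opposite (τ ⟨$⟩ˡ w) ≡ i
    surjective i = τ ⟨$⟩ʳ opposite i ,
      λ { refl → trans (cong opposite (inverseˡ τ)) (FinP.opposite-involutive i) }

  ranking-of : Labeling H → Permutation′ (size H)
  ranking-of ℓ = permutation vertex-of (opposite ∘ label ℓ) vertex-rank rank-vertex
    where
    vertex-of : Fin (size H) → Vertex H
    vertex-of i = proj₁ (proj₂ (bijective ℓ) (opposite i))
    labels-vertex-of : ∀ i → label ℓ (vertex-of i) ≡ opposite i
    labels-vertex-of i = proj₂ (proj₂ (bijective ℓ) (opposite i)) refl
    vertex-rank : ∀ v → vertex-of (opposite (label ℓ v)) ≡ v
    vertex-rank v = proj₁ (bijective ℓ)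
      (trans (labels-vertex-of _) (FinP.opposite-involutive (label ℓ v)))
    rank-vertex : ∀ i → opposite (label ℓ (vertex-of i)) ≡ i
    rank-vertex i = trans (cong opposite (labels-vertex-of i)) (FinP.opposite-involutive i)

  ranking-spec : ∀ ℓ v → label ℓ v ≡ opposite (ranking-of ℓ ⟨$⟩ˡ v)
  ranking-spec ℓ v = sym (FinP.opposite-involutive (label ℓ v))

  ranking-unique : ∀ ℓ τ → (∀ v → label ℓ v ≡ opposite (τ ⟨$⟩ˡ v)) → ranking-of ℓ Perm.≈ τ
  ranking-unique ℓ τ spec i = begin
    v                                 ≡⟨ inverseʳ τ ⟨
    τ ⟨$⟩ʳ (τ ⟨$⟩ˡ v)                 ≡⟨ cong (τ ⟨$⟩ʳ_) (opposite-injective (trans (sym (spec v)) (ranking-spec ℓ v))) ⟩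
    τ ⟨$⟩ʳ (ranking-of ℓ ⟨$⟩ˡ v)      ≡⟨ cong (τ ⟨$⟩ʳ_) (inverseˡ (ranking-of ℓ)) ⟩
    τ ⟨$⟩ʳ i                          ∎
    where
    open ≡-Reasoning
    v : Vertex H
    v = ranking-of ℓ ⟨$⟩ʳ i

  inverse-cong : ∀ {τ τ′ : Permutation′ (size H)} → τ Perm.≈ τ′ → ∀ v → τ ⟨$⟩ˡ v ≡ τ′ ⟨$⟩ˡ v
  inverse-cong {τ} {τ′} τ≈τ′ v = begin
    τ ⟨$⟩ˡ v                        ≡⟨ inverseˡ τ′ ⟨
    τ′ ⟨$⟩ˡ (τ′ ⟨$⟩ʳ (τ ⟨$⟩ˡ v))    ≡⟨ cong (τ′ ⟨$⟩ˡ_) (trans (sym (τ≈τ′ _)) (inverseʳ τ)) ⟩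
    τ′ ⟨$⟩ˡ v                       ∎
    where open ≡-Reasoning

count-≥1 : ∀ {N} {A : Set} {P : A → Set} (P? : Decidable P) (h : Fin N → A) {i}
  → P (h i) → 1 ≤ count P? (tabulate h)
count-≥1 P? h {zero} p with P? (h zero)
... | yes _  = s≤s z≤n
... | no ¬p₀ = ⊥-elim (¬p₀ p)
count-≥1 P? h {suc i} p with P? (h zero)
... | yes _ = s≤s z≤n
... | no _  = count-≥1 P? (h ∘ suc) p

count-≥2 : ∀ {N} {A : Set} {P : A → Set} (P? : Decidable P) (h : Fin N → A) {i j}
  → i ≢ j → P (h i) → P (h j) → 2 ≤ count P? (tabulate h)
count-≥2 P? h {zero}  {zero}  i≢j _ _ = ⊥-elim (i≢j refl)
count-≥2 P? h {zero}  {suc j} _ pi pj with P? (h zero)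
... | yes _  = s≤s (count-≥1 P? (h ∘ suc) pj)
... | no ¬p₀ = ⊥-elim (¬p₀ pi)
count-≥2 P? h {suc i} {zero}  _ pi pj with P? (h zero)
... | yes _  = s≤s (count-≥1 P? (h ∘ suc) pi)
... | no ¬p₀ = ⊥-elim (¬p₀ pj)
count-≥2 P? h {suc i} {suc j} i≢j pi pj with P? (h zero)
... | yes _ = ℕ.m≤n⇒m≤1+n (count-≥2 P? (h ∘ suc) (i≢j ∘ cong suc) pi pj)
... | no _  = count-≥2 P? (h ∘ suc) (i≢j ∘ cong suc) pi pj

two-neighbours : (H : Graph) (v : Vertex H) {w w′ : Vertex H}
  → w ≢ w′ → Adj H v w → Adj H v w′ → 2 ≤ deg H v
two-neighbours H v = count-≥2 (λ w → T? (adj H v w)) (λ w → w)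

larger-neighbour : (H : Graph) (ℓ : Labeling H) (v : Vertex H) → 2 ≤ deg H v → ¬ IsPeak H ℓ v
  → ∃ λ w → Adj H v w × label ℓ v F.< label ℓ w
larger-neighbour H ℓ v deg≥2 not-peak = w , v~w , ℕ.≤∧≢⇒< (ℕ.≮⇒≥ w≮v) labels-differ
  where
  LowerIfAdjacent : Vertex H → Set
  LowerIfAdjacent w = Adj H v w → label ℓ w F.< label ℓ v

  counterexample : ∃ λ w → ¬ LowerIfAdjacent w
  counterexample = FinP.¬∀⟶∃¬ (size H) LowerIfAdjacent
    (λ w → T? (adj H v w) →-dec (label ℓ w F.<? label ℓ v)) (λ lower → not-peak (deg≥2 , lower))
  w : Vertex H
  w = proj₁ counterexample

  v~w : Adj H v w
  v~w with T? (adj H v w)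
  ... | yes v~w  = v~w
  ... | no ¬v~w = ⊥-elim (proj₂ counterexample (⊥-elim ∘ ¬v~w))

  w≮v : ¬ label ℓ w F.< label ℓ v
  w≮v w<v = proj₂ counterexample (λ _ → w<v)

  -- v ≠ w since graphs have no loops, and labels are injective
  labels-differ : toℕ (label ℓ v) ≢ toℕ (label ℓ w)
  labels-differ e = subst T (adj-irrefl H v)
    (subst (Adj H v) (sym (proj₁ (bijective ℓ) (FinP.toℕ-injective e))) v~w)

nullKind : Bool → Kind
nullKind true  = sel
nullKind false = unsel

nullKind≢hub : ∀ b → nullKind b ≢ hub
nullKind≢hub true  ()
nullKind≢hub false ()

nullKind≡sel : ∀ {b} → nullKind b ≡ sel → b ≡ true
nullKind≡sel {true} _ = refl

occ-subset : ∀ {n} (S : Subset n) → occ (nullKind ∘ lookup S) sel ≡ ∣ S ∣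
occ-subset []          = refl
occ-subset (true  ∷ S) = cong suc (occ-subset S)
occ-subset (false ∷ S) = occ-subset S

module JoinWithNull (n : ℕ) (G : Graph) (S : Subset n) where

  m : ℕ
  m = size G

  H : Graph
  H = nullGraph n ∨ᴳ G

  Sᴴ : Vertex H → Set
  Sᴴ = leftSubset n G S

  sideKind : Fin n ⊎ Fin m → Kind
  sideKind (inj₁ i) = nullKind (lookup S i)
  sideKind (inj₂ _) = hub

  kind : Vertex H → Kind
  kind v = sideKind (splitAt n v)

  sel⇒S : ∀ v → kind v ≡ sel → Sᴴ v
  sel⇒S v with splitAt n v
  ... | inj₁ i = λ i-sel → lookup⇒[]= i S (nullKind≡sel i-sel)
  ... | inj₂ _ = λ ()

  S⇒sel : ∀ v → Sᴴ v → kind v ≡ sel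
  S⇒sel v with splitAt n v
  ... | inj₁ i = λ i∈S → cong nullKind ([]=⇒lookup i∈S)
  ... | inj₂ _ = λ ()

  hub-kind : ∀ j → kind (n ↑ʳ j) ≡ hub
  hub-kind j rewrite FinP.splitAt-↑ʳ n m j = refl

  sideAdj : Fin n ⊎ Fin m → Fin n ⊎ Fin m → Bool
  sideAdj = joinAdj (λ _ _ → false) (adj G)

  null-hub-adjacent : ∀ x y → sideKind x ≢ hub → sideKind y ≡ hub → T (sideAdj x y)
  null-hub-adjacent (inj₁ _) (inj₂ _) _ _ = tt
  null-hub-adjacent (inj₁ _) (inj₁ j) _ y-hub = ⊥-elim (nullKind≢hub (lookup S j) y-hub)
  null-hub-adjacent (inj₂ _) _ x≢hub _ = ⊥-elim (x≢hub refl)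

  null-neighbours : ∀ x y → sideKind x ≢ hub → T (sideAdj x y) → sideKind y ≡ hub
  null-neighbours (inj₁ _) (inj₂ _) _ _ = refl
  null-neighbours (inj₂ _) _ x≢hub _ = ⊥-elim (x≢hub refl)

  adjacent-to-hubs : ∀ v w → kind v ≢ hub → kind w ≡ hub → Adj H v w
  adjacent-to-hubs v w = null-hub-adjacent (splitAt n v) (splitAt n w)

  hubs-adjacent : ∀ v w → kind v ≡ hub → kind w ≢ hub → Adj H v w
  hubs-adjacent v w v-hub w≢hub = subst T (adj-sym H w v) (adjacent-to-hubs w v w≢hub v-hub)

  only-hubs : ∀ v w → kind v ≢ hub → Adj H v w → kind w ≡ hub
  only-hubs v w = null-neighbours (splitAt n v) (splitAt n w)

  null-degree : 1 < m → ∀ v → kind v ≢ hub → 2 ≤ deg H v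
  null-degree 1<m v v≢hub =
    two-neighbours H v h₀≢h₁ (adjacent-to-hubs v h₀ v≢hub (hub-kind _))
                             (adjacent-to-hubs v h₁ v≢hub (hub-kind _))
    where
    0<m : 0 < m
    0<m = ℕ.<-trans (s≤s z≤n) 1<m
    h₀ h₁ : Vertex H
    h₀ = n ↑ʳ F.fromℕ< {0} 0<m
    h₁ = n ↑ʳ F.fromℕ< {1} 1<m
    h₀≢h₁ : h₀ ≢ h₁
    h₀≢h₁ e with trans (sym (FinP.toℕ-fromℕ< 0<m))
                 (trans (cong toℕ (FinP.↑ʳ-injective n _ _ e)) (FinP.toℕ-fromℕ< 1<m))
    ... | ()

  occ-sel : occ kind sel ≡ ∣ S ∣
  occ-sel = begin
    occ kind sel                                            ≡⟨ occ-splitAt n sideKind sel ⟩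
    occ (nullKind ∘ lookup S) sel + occ {m} (λ _ → hub) sel
      ≡⟨ cong₂ _+_ (occ-subset S) (occ-none {m} (λ _ → hub) sel (λ _ ())) ⟩
    ∣ S ∣ + 0                                               ≡⟨ ℕ.+-identityʳ ∣ S ∣ ⟩
    ∣ S ∣                                                   ∎
    where open ≡-Reasoning

  occ-hub : occ kind hub ≡ m
  occ-hub = begin
    occ kind hub                                   ≡⟨ occ-splitAt n sideKind hub ⟩
    occ (nullKind ∘ lookup S) hub + occ {m} (λ _ → hub) hub
      ≡⟨ cong₂ _+_ (occ-none _ hub (nullKind≢hub ∘ lookup S)) (occ-const m hub) ⟩
    m                                              ∎
    where open ≡-Reasoning

  -- Peaks of ℓ are exactly S ⇒ ℓ separates: a sel vertex is a peak above its
  -- neighbours, the hubs; an unsel vertex is no peak, so one of its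
  -- neighbours — necessarily a hub — is above it.
  peaks⇒separated : 1 < m → (ℓ : Labeling H) → PeakSetIs H ℓ Sᴴ → Separated kind (label ℓ)
  peaks⇒separated 1<m ℓ peaks = above , below
    where
    above : ∀ s w → kind s ≡ sel → kind w ≡ hub → label ℓ w F.< label ℓ s
    above s w s-sel w-hub = proj₂ (Equivalence.from (peaks s) (sel⇒S s s-sel)) w
      (adjacent-to-hubs s w (sel≢hub ∘ trans (sym s-sel)) w-hub)

    below : ∀ u → kind u ≡ unsel → ∃ λ w → kind w ≡ hub × label ℓ u F.< label ℓ w
    below u u-unsel =
      let (w , u~w , u<w) = larger-neighbour H ℓ u (null-degree 1<m u u≢hub) not-peak
      in w , only-hubs u w u≢hub u~w , u<w
      where
      u≢hub : kind u ≢ hub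
      u≢hub = unsel≢hub ∘ trans (sym u-unsel)
      not-peak : ¬ IsPeak H ℓ u
      not-peak peak = sel≢unsel (trans (sym (S⇒sel u (Equivalence.to (peaks u) peak))) u-unsel)

  -- ℓ separates ⇒ peaks of ℓ are exactly S: a sel vertex has degree ≥ 2 and
  -- only hubs as neighbours; an unsel vertex lies below an adjacent hub; a hub
  -- lies below the (adjacent) members of S ≠ ∅.
  separated⇒peaks : Nonempty S → 1 < m → (ℓ : Labeling H) → Separated kind (label ℓ) → PeakSetIs H ℓ Sᴴ
  separated⇒peaks (i₀ , i₀∈S) 1<m ℓ (above , below) v = mk⇔ peak⇒S S⇒peak
    where
    s₀ : Vertex H
    s₀ = i₀ ↑ˡ m
    s₀-sel : kind s₀ ≡ sel
    s₀-sel rewrite FinP.splitAt-↑ˡ n i₀ m | []=⇒lookup i₀∈S = refl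

    S⇒peak : Sᴴ v → IsPeak H ℓ v
    S⇒peak v∈S = null-degree 1<m v v≢hub , λ w v~w → above v w v-sel (only-hubs v w v≢hub v~w)
      where
      v-sel : kind v ≡ sel
      v-sel = S⇒sel v v∈S
      v≢hub : kind v ≢ hub
      v≢hub = sel≢hub ∘ trans (sym v-sel)

    peak⇒S : IsPeak H ℓ v → Sᴴ v
    peak⇒S (_ , is-max) with kind v in v-kind
    ... | sel   = sel⇒S v v-kind
    ... | unsel =
      let (w , w-hub , v<w) = below v v-kind
      in ⊥-elim (ℕ.<-asym v<w (is-max w (adjacent-to-hubs v w (unsel≢hub ∘ trans (sym v-kind)) w-hub)))
    ... | hub =
      ⊥-elim (ℕ.<-asym (above s₀ v s₀-sel v-kind)
                       (is-max s₀ (hubs-adjacent v s₀ v-kind (sel≢hub ∘ trans (sym s₀-sel)))))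

  rankings≅labelings : Nonempty S → 1 < m → Inverse (GoodRankings kind) (P H Sᴴ)
  rankings≅labelings nonempty 1<m =
    mkInverse {GoodRankings kind} {P H Sᴴ} to from
      (λ {x} {y} → to-cong {x} {y}) (λ {x} {y} → from-cong {x} {y}) to-from from-to
    where
    peaks⇔good : ∀ ℓ τ → (∀ v → label ℓ v ≡ opposite (τ ⟨$⟩ˡ v))
      → PeakSetIs H ℓ Sᴴ ⇔ Good (kind ∘ (τ ⟨$⟩ʳ_))
    peaks⇔good ℓ τ spec = Composition.equivalence
      (mk⇔ (peaks⇒separated 1<m ℓ) (separated⇒peaks nonempty 1<m ℓ))
      (separated⇔good kind (label ℓ) τ spec)

    to : Carrier (GoodRankings kind) → Carrier (P H Sᴴ)
    to (τ , good) = labeling-of H τ , Equivalence.from (peaks⇔good (labeling-of H τ) τ (λ _ → refl)) good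

    from : Carrier (P H Sᴴ) → Carrier (GoodRankings kind)
    from (ℓ , peaks) = ranking-of H ℓ , Equivalence.to (peaks⇔good ℓ (ranking-of H ℓ) (ranking-spec H ℓ)) peaks

    to-cong : ∀ {x y} → Setoid._≈_ (GoodRankings kind) x y → Setoid._≈_ (P H Sᴴ) (to x) (to y)
    to-cong {τ , _} {τ′ , _} τ≈τ′ v = cong opposite (inverse-cong H {τ} {τ′} τ≈τ′ v)

    from-cong : ∀ {x y} → Setoid._≈_ (P H Sᴴ) x y → Setoid._≈_ (GoodRankings kind) (from x) (from y)
    from-cong {ℓ , _} {ℓ′ , _} ℓ≈ℓ′ =
      ranking-unique H ℓ (ranking-of H ℓ′) (λ v → trans (ℓ≈ℓ′ v) (ranking-spec H ℓ′ v))

    to-from : ∀ x → Setoid._≈_ (P H Sᴴ) (to (from x)) x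
    to-from (ℓ , _) v = FinP.opposite-involutive (label ℓ v)

    from-to : ∀ x → Setoid._≈_ (GoodRankings kind) (from (to x)) x
    from-to (τ , _) = ranking-unique H (labeling-of H τ) τ (λ _ → refl)

size-split : ∀ n m k → k ≤ n → 1 ≤ m → n + m ≡ k + suc (n + m ∸ k ∸ 1)
size-split n m k k≤n 1≤m = sym (begin
  k + suc (n + m ∸ k ∸ 1)    ≡⟨ ℕ.+-suc k _ ⟩
  suc k + (n + m ∸ k ∸ 1)    ≡⟨ cong (suc k +_) (ℕ.∸-+-assoc (n + m) k 1) ⟩
  suc k + (n + m ∸ (k + 1))  ≡⟨ cong (λ j → suc k + (n + m ∸ j)) (ℕ.+-comm k 1) ⟩
  suc k + (n + m ∸ suc k)    ≡⟨ ℕ.m+[n∸m]≡n suc-k≤n+m ⟩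
  n + m                      ∎)
  where
  open ≡-Reasoning
  suc-k≤n+m : suc k ≤ n + m
  suc-k≤n+m = ℕ.≤-trans (s≤s k≤n) (subst (_≤ n + m) (ℕ.+-comm n 1) (ℕ.+-monoʳ-≤ n 1≤m))

proposition3p2 : (n : ℕ) → 1 ≤ n → (G : Graph) → 1 < size G
    → (S : Subset n) → Nonempty S
    → Admissible (nullGraph n ∨ᴳ G) (leftSubset n G S)
      × Inverse (setoid (Fin ((∣ S ∣ !) * size G * (((n + size G) ∸ ∣ S ∣ ∸ 1) !))))
                (P (nullGraph n ∨ᴳ G) (leftSubset n G S))
-- (The hypothesis n ≥ 1 is implied by S ≠ ∅ and not needed separately.)
proposition3p2 n _ G 1<m S nonempty = Inverse.to enumeration (F.fromℕ< positive) , enumeration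
  where
  open JoinWithNull n G S
  k r : ℕ
  k = ∣ S ∣
  r = n + m ∸ k ∸ 1
  0<m : 0 < m
  0<m = ℕ.<-trans (s≤s z≤n) 1<m

  enumeration : Enumeration (k ! * m * r !) (P H Sᴴ)
  enumeration =
    good-rankings k r m (size-split n m k (∣p∣≤n S) 0<m) kind occ-sel occ-hub
      ⨾ rankings≅labelings nonempty 1<m

  positive : 0 < k ! * m * r !
  positive = ℕ.*-mono-≤ (ℕ.*-mono-≤ (ℕ.1≤n! k) 0<m) (ℕ.1≤n! r)
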